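{- Let $(A,V)$ and $(B,W)$ be permutation groups with $A\in GR\cup\{I_2\}$, and suppose $A$ has $t\geq 1$ orbits. If $I_t\times B\in GR$, then $A\wr B\in GR$.
   Context: Permutation groups are considered up to permutation isomorphism and act on sets with more than one element. A colored graph is a pair $(V,E)$ with $E$ a function from the unordered pairs of distinct vertices to a set of colors; automorphisms are color-preserving permutations of the vertices. $GR$ is the class of permutation groups that are the automorphism group of some colored graph. $I_n$ denotes the identity group on an $n$-element set. The group $I_t\times B$ acts on $\{1,\dots,t\}\times W$ by $(i,w)\mapsto (i,w\beta)$, $\beta\in B$. The (imprimitive) wreath product $A\wr B$ is the permutation group on $V\times W$ of all permutations $\gamma$ for which there are $\alpha_w\in A$ ($w\in W$) and $\beta\in B$ with $(v,w)\gamma=(v\alpha_w,w\beta)$ for all $(v,w)$. -}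

module Defs where

open import Data.Nat using (ℕ)
open import Data.Fin using (Fin)
open import Data.Product using (Σ; ∃; _×_; _,_)
open import Function using (_↔_; Inverse; Surjective; _⇔_)
open import Function.Construct.Identity using (↔-id)
open import Function.Construct.Composition using (_↔-∘_)
open import Function.Construct.Symmetry using (↔-sym)
open import Relation.Binary.PropositionalEquality using (_≡_; _≢_)

Perm : Set → Set
Perm X = X ↔ X

_·_ : {X : Set} → Perm X → X → X
σ · x = Inverse.to σ x

infixr 9 _·_

-- A permutation group on X, given by its membership predicate
-- (membership respects pointwise equality of permutations).
record IsPermGroup {X : Set} (G : Perm X → Set) : Set where
  field
    respects  : ∀ σ τ → (∀ x → σ · x ≡ τ · x) → G σ → G τ
    has-id    : G (↔-id X)
    closed-∘  : ∀ σ τ → G σ → G τ → G (τ ↔-∘ σ)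
    closed-⁻¹ : ∀ σ → G σ → G (↔-sym σ)

-- A colored graph on vertex set X: a set of colors and a function from
-- unordered pairs of distinct vertices to colors, represented as
-- E : X → X → Color that is symmetric on distinct vertices.
record ColoredGraph (X : Set) : Set₁ where
  field
    Color : Set
    E     : X → X → Color
    E-sym : ∀ x y → x ≢ y → E x y ≡ E y x

IsAut : {X : Set} → ColoredGraph X → Perm X → Set
IsAut Γ σ = ∀ x y → x ≢ y → E (σ · x) (σ · y) ≡ E x y
  where open ColoredGraph Γ

conj : {X Y : Set} → X ↔ Y → Perm X → Perm Y
conj φ σ = φ ↔-∘ (σ ↔-∘ ↔-sym φ)

GR : {X : Set} → (Perm X → Set) → Set₁
GR {X} G = Σ Set λ Y → Σ (X ↔ Y) λ φ → Σ (ColoredGraph Y) λ Γ →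
  ∀ (σ : Perm X) → G σ ⇔ IsAut Γ (conj φ σ)

IsI₂ : {X : Set} → (Perm X → Set) → Set
IsI₂ {X} G = (X ↔ Fin 2) × (∀ (σ : Perm X) → G σ ⇔ (∀ x → σ · x ≡ x))

HasOrbits : {X : Set} → (Perm X → Set) → ℕ → Set
HasOrbits {X} G t = Σ (X → Fin t) λ f → Surjective _≡_ _≡_ f ×
  (∀ x y → (f x ≡ f y) ⇔ (∃ λ σ → G σ × σ · x ≡ y))

IdTimes : (t : ℕ) {W : Set} → (Perm W → Set) → Perm (Fin t × W) → Set
IdTimes t {W} B γ = ∃ λ β → B β × (∀ i w → γ · (i , w) ≡ (i , β · w))

Wreath : {V W : Set} → (Perm V → Set) → (Perm W → Set) → Perm (V × W) → Set
Wreath {V} {W} A B γ =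
  Σ (W → Perm V) λ α → (∀ w → A (α w)) × ∃ λ β → B β ×
    (∀ v w → γ · (v , w) ≡ (α w · v , β · w))

-- A ≀ B is the automorphism group of a graph on V × W whose edge colours
-- record two things: inside a block V × {w}, the colour of A's graph Γ on V
-- (monochrome when A = I₂); and, for every edge, the colour in the graph Δ of
-- I_t × B between the images of its ends in Fin t × W, where V → Fin t is the
-- orbit map of A.  The first component forces an automorphism γ to map blocks
-- to blocks, so γ (v , w) = (α_w v , β w) with every α_w an automorphism of Γ.
-- The second forces each α_w to preserve the orbits of A (when A ∈ GR this
-- already follows from α_w ∈ Aut Γ = A; when A = I₂ the orbit map is a
-- bijection and γ itself induces an automorphism of Δ, which fixes the first
-- coordinate), so α_w ∈ A, and then β induces the automorphism I_t × β of Δ,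
-- so β ∈ B.

module Submission where

open import Defs
open import Data.Nat using (ℕ; _≥_)
open import Data.Fin using (Fin; fromℕ<)
open import Data.Fin.Properties using () renaming (_≟_ to _≟ᶠ_)
open import Data.Bool using (if_then_else_)
open import Data.Maybe using (Maybe; just; nothing)
open import Data.Maybe.Properties using (just-injective)
open import Data.Product using (Σ; ∃; _×_; _,_; proj₁; proj₂)
open import Data.Product.Properties using (≡-dec)
open import Data.Sum using (_⊎_; inj₁; inj₂; [_,_]′)
open import Data.Unit using (⊤; tt)
open import Function using (_∘_; _↔_; Inverse; Injection; _⇔_; Equivalence; mk↔ₛ′; mk⇔)
open import Function.Definitions using (Injective; Surjective)
open import Function.Consequences.Propositional using (surjective⇒strictlySurjective)
open import Function.Construct.Composition using (_⇔-∘_)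
open import Function.Construct.Identity using (↔-id)
open import Function.Construct.Symmetry using (↔-sym)
open import Function.Properties.Inverse using (↔⇒↣)
open import Relation.Binary.Definitions using (DecidableEquality)
open import Relation.Binary.PropositionalEquality
  using (_≡_; _≢_; refl; sym; trans; cong; cong₂; subst₂; module ≡-Reasoning)
open import Relation.Nullary using (yes; no; does)
open import Relation.Nullary.Decidable using (dec-true; dec-false)

open Inverse using (strictlyInverseˡ; strictlyInverseʳ)
open Equivalence using (to; from)

_⁻·_ : {X : Set} → Perm X → X → X
σ ⁻· x = Inverse.from σ x

↔-injective : {X Y : Set} (ψ : X ↔ Y) → Injective _≡_ _≡_ (Inverse.to ψ)
↔-injective ψ = Injection.injective (↔⇒↣ ψ)

Invariant : {V T : Set} → (V → T) → Perm V → Set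
Invariant f α = ∀ v → f (α · v) ≡ f v

pullback : {X Y : Set} → X ↔ Y → ColoredGraph Y → ColoredGraph X
pullback ψ Γ = record
  { Color = Color
  ; E     = λ x x' → E (Inverse.to ψ x) (Inverse.to ψ x')
  ; E-sym = λ x x' x≢x' → E-sym _ _ (x≢x' ∘ ↔-injective ψ)
  }
  where open ColoredGraph Γ

IsAut-pullback : {X Y : Set} (ψ : X ↔ Y) (Γ : ColoredGraph Y) (σ : Perm X) →
                 IsAut Γ (conj ψ σ) ⇔ IsAut (pullback ψ Γ) σ
IsAut-pullback ψ Γ σ = mk⇔ restrict extend
  where
  open ColoredGraph Γ
  ψ· = Inverse.to ψ
  ψ⁻ = Inverse.from ψ

  restrict : IsAut Γ (conj ψ σ) → IsAut (pullback ψ Γ) σ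
  restrict aut x x' x≢x' =
    subst₂ (λ a b → E (ψ· (σ · a)) (ψ· (σ · b)) ≡ E (ψ· x) (ψ· x'))
      (strictlyInverseʳ ψ x) (strictlyInverseʳ ψ x')
      (aut (ψ· x) (ψ· x') (x≢x' ∘ ↔-injective ψ))

  extend : IsAut (pullback ψ Γ) σ → IsAut Γ (conj ψ σ)
  extend aut y y' y≢y' =
    trans (aut (ψ⁻ y) (ψ⁻ y') (y≢y' ∘ ↔-injective (↔-sym ψ)))
          (cong₂ E (strictlyInverseˡ ψ y) (strictlyInverseˡ ψ y'))

GR⇒IsAut : {X : Set} {G : Perm X → Set} → GR G →
           Σ (ColoredGraph X) λ Γ → ∀ σ → G σ ⇔ IsAut Γ σ
GR⇒IsAut (_ , ψ , Γ , G⇔) = pullback ψ Γ , λ σ → IsAut-pullback ψ Γ σ ⇔-∘ G⇔ σ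

IsAut⇒GR : {X : Set} {G : Perm X → Set} (Γ : ColoredGraph X) →
           (∀ σ → G σ ⇔ IsAut Γ σ) → GR G
IsAut⇒GR {X} Γ G⇔ = X , ↔-id X , Γ , G⇔

IsAut-⁻¹ : {X : Set} (Γ : ColoredGraph X) (σ : Perm X) → IsAut Γ σ → IsAut Γ (↔-sym σ)
IsAut-⁻¹ Γ σ aut x y x≢y =
  sym (subst₂ (λ a b → E a b ≡ E (σ ⁻· x) (σ ⁻· y))
         (strictlyInverseˡ σ x) (strictlyInverseˡ σ y)
         (aut (σ ⁻· x) (σ ⁻· y) (x≢y ∘ ↔-injective (↔-sym σ))))
  where open ColoredGraph Γ

-- Colourings made total on the diagonal

module Diagonal {Z : Set} (_≟_ : DecidableEquality Z) (Δ : ColoredGraph Z) where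
  open ColoredGraph Δ

  E⁼ : Z → Z → Maybe Color
  E⁼ z z' = if does (z ≟ z') then nothing else just (E z z')

  E⁼-refl : ∀ z → E⁼ z z ≡ nothing
  E⁼-refl z rewrite dec-true (z ≟ z) refl = refl

  E⁼-≢ : ∀ {z z'} → z ≢ z' → E⁼ z z' ≡ just (E z z')
  E⁼-≢ {z} {z'} z≢z' rewrite dec-false (z ≟ z') z≢z' = refl

  E⁼-sym : ∀ z z' → E⁼ z z' ≡ E⁼ z' z
  E⁼-sym z z' with z ≟ z'
  ... | yes refl = sym (E⁼-refl z)
  ... | no z≢z'  = trans (cong just (E-sym z z' z≢z')) (sym (E⁼-≢ (z≢z' ∘ sym)))

  IsAut⇒E⁼-invariant : (δ : Perm Z) → IsAut Δ δ → ∀ z z' → E⁼ (δ · z) (δ · z') ≡ E⁼ z z'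
  IsAut⇒E⁼-invariant δ aut z z' with z ≟ z'
  ... | yes refl = E⁼-refl (δ · z)
  ... | no z≢z'  = trans (E⁼-≢ (z≢z' ∘ ↔-injective δ)) (cong just (aut z z' z≢z'))

  E⁼-invariant⇒IsAut : (δ : Perm Z) →
    (∀ z z' → z ≢ z' → E⁼ (δ · z) (δ · z') ≡ E⁼ z z') → IsAut Δ δ
  E⁼-invariant⇒IsAut δ inv z z' z≢z' =
    just-injective (trans (sym (E⁼-≢ (z≢z' ∘ ↔-injective δ)))
                          (trans (inv z z' z≢z') (E⁼-≢ z≢z')))

idTimes : (t : ℕ) {W : Set} → Perm W → Perm (Fin t × W)
idTimes t β = mk↔ₛ′ (λ z → proj₁ z , β · proj₂ z) (λ z → proj₁ z , β ⁻· proj₂ z)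
  (λ z → cong (proj₁ z ,_) (strictlyInverseˡ β (proj₂ z)))
  (λ z → cong (proj₁ z ,_) (strictlyInverseʳ β (proj₂ z)))

module _ {t : ℕ} {W : Set} {B : Perm W → Set} where

  IdTimes-idTimes : ∀ {β} → B β → IdTimes t B (idTimes t β)
  IdTimes-idTimes {β} Bβ = β , Bβ , λ _ _ → refl

  IdTimes-idTimes⁻ : IsPermGroup B → Fin t → ∀ {β} → IdTimes t B (idTimes t β) → B β
  IdTimes-idTimes⁻ B-group i {β} (β' , Bβ' , β'-action) =
    IsPermGroup.respects B-group β' β (λ w → sym (cong proj₂ (β'-action i w))) Bβ'

  IdTimes-fixes-proj₁ : ∀ {δ} → IdTimes t B δ → ∀ z → proj₁ (δ · z) ≡ proj₁ z
  IdTimes-fixes-proj₁ (_ , _ , β-action) (i , w) = cong proj₁ (β-action i w)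

PreservesBlocks : {V W : Set} → Perm (V × W) → Set
PreservesBlocks γ = ∀ v v' w → proj₂ (γ · (v , w)) ≡ proj₂ (γ · (v' , w))

module Blockwise {V W : Set} (v₀ : V) (γ : Perm (V × W))
  (γ-blocks : PreservesBlocks γ) (γ⁻¹-blocks : PreservesBlocks (↔-sym γ)) where

  blockPerm : Perm W
  blockPerm = mk↔ₛ′ (λ w → proj₂ (γ · (v₀ , w))) (λ w → proj₂ (γ ⁻· (v₀ , w)))
    (λ w → trans (γ-blocks v₀ _ _) (cong proj₂ (strictlyInverseˡ γ (v₀ , w))))
    (λ w → trans (γ⁻¹-blocks v₀ _ _) (cong proj₂ (strictlyInverseʳ γ (v₀ , w))))

  fibrePerm : W → Perm V
  fibrePerm w = mk↔ₛ′ (λ v → proj₁ (γ · (v , w))) (λ v → proj₁ (γ ⁻· (v , blockPerm · w)))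
    (λ v → trans (cong (λ u → proj₁ (γ · (proj₁ (γ ⁻· (v , blockPerm · w)) , u)))
                       (sym (γ⁻¹-lands-in-w v)))
                 (cong proj₁ (strictlyInverseˡ γ (v , blockPerm · w))))
    (λ v → trans (cong (λ u → proj₁ (γ ⁻· (proj₁ (γ · (v , w)) , u))) (γ-blocks v₀ v w))
                 (cong proj₁ (strictlyInverseʳ γ (v , w))))
    where
    γ⁻¹-lands-in-w : ∀ v → proj₂ (γ ⁻· (v , blockPerm · w)) ≡ w
    γ⁻¹-lands-in-w v = trans (γ⁻¹-blocks v v₀ _) (strictlyInverseʳ blockPerm w)

  decomposition : ∀ v w → γ · (v , w) ≡ (fibrePerm w · v , blockPerm · w)
  decomposition v w = cong (proj₁ (γ · (v , w)) ,_) (γ-blocks v v₀ w)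

module _ {X : Set} {G : Perm X → Set} {t : ℕ} (f : X → Fin t)
  (orbits : ∀ x y → (f x ≡ f y) ⇔ (∃ λ σ → G σ × σ · x ≡ y)) where

  HasOrbits-invariant : ∀ σ → G σ → Invariant f σ
  HasOrbits-invariant σ Gσ x = sym (from (orbits x (σ · x)) (σ , Gσ , refl))

  HasOrbits-injective : (∀ σ → G σ → ∀ x → σ · x ≡ x) → Injective _≡_ _≡_ f
  HasOrbits-injective G-trivial {x} {y} fx≡fy with to (orbits x y) fx≡fy
  ... | σ , Gσ , σx≡y = trans (sym (G-trivial σ Gσ x)) σx≡y

-- The graph whose automorphism group is A ≀ B

module WreathGraph {V W : Set} (_≟ᵂ_ : DecidableEquality W) {t : ℕ}
  (Γ : ColoredGraph V) (Δ : ColoredGraph (Fin t × W))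
  (f : V → Fin t) (f-surjective : Surjective _≡_ _≡_ f) where

  open ColoredGraph Γ using () renaming (Color to Colorᴳ; E to Eᴳ; E-sym to Eᴳ-sym)
  open Diagonal (≡-dec _≟ᶠ_ _≟ᵂ_) Δ

  s : Fin t → V
  s i = proj₁ (surjective⇒strictlySurjective f-surjective i)

  f∘s : ∀ i → f (s i) ≡ i
  f∘s i = proj₂ (surjective⇒strictlySurjective f-surjective i)

  orbitOf : V × W → Fin t × W
  orbitOf (v , w) = f v , w

  sameBlock : V × W → V × W → Maybe Colorᴳ
  sameBlock (v , w) (v' , w') = if does (w ≟ᵂ w') then just (Eᴳ v v') else nothing

  sameBlock-≡ : ∀ v v' w → sameBlock (v , w) (v' , w) ≡ just (Eᴳ v v')
  sameBlock-≡ v v' w rewrite dec-true (w ≟ᵂ w) refl = refl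

  sameBlock-≢ : ∀ v v' {w w'} → w ≢ w' → sameBlock (v , w) (v' , w') ≡ nothing
  sameBlock-≢ v v' {w} {w'} w≢w' rewrite dec-false (w ≟ᵂ w') w≢w' = refl

  sameBlock-sym : ∀ x y → x ≢ y → sameBlock x y ≡ sameBlock y x
  sameBlock-sym (v , w) (v' , w') x≢y with w ≟ᵂ w'
  ... | yes refl = trans (cong just (Eᴳ-sym v v' (x≢y ∘ cong (_, w)))) (sym (sameBlock-≡ v' v w))
  ... | no w≢w'  = sym (sameBlock-≢ v' v (w≢w' ∘ sym))

  wreathGraph : ColoredGraph (V × W)
  wreathGraph = record
    { Color = Maybe Colorᴳ × Maybe (ColoredGraph.Color Δ)
    ; E     = λ x y → sameBlock x y , E⁼ (orbitOf x) (orbitOf y)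
    ; E-sym = λ x y x≢y → cong₂ _,_ (sameBlock-sym x y x≢y) (E⁼-sym _ _)
    }

  blockwise⇒IsAut : (α : W → Perm V) (β : Perm W) (γ : Perm (V × W)) →
    (∀ w → IsAut Γ (α w)) → (∀ w → Invariant f (α w)) → IsAut Δ (idTimes t β) →
    (∀ v w → γ · (v , w) ≡ (α w · v , β · w)) → IsAut wreathGraph γ
  blockwise⇒IsAut α β γ α-aut α-invariant β-aut γ-action (v , w) (v' , w') x≢y
    rewrite γ-action v w | γ-action v' w' = cong₂ _,_ blocks orbits
    where
    blocks : sameBlock (α w · v , β · w) (α w' · v' , β · w') ≡ sameBlock (v , w) (v' , w')
    blocks with w ≟ᵂ w'
    ... | yes refl = trans (sameBlock-≡ _ _ _) (cong just (α-aut w v v' (x≢y ∘ cong (_, w))))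
    ... | no w≢w'  = sameBlock-≢ _ _ (w≢w' ∘ ↔-injective β)

    orbits : E⁼ (f (α w · v) , β · w) (f (α w' · v') , β · w') ≡ E⁼ (f v , w) (f v' , w')
    orbits = trans (cong₂ (λ j j' → E⁼ (j , β · w) (j' , β · w')) (α-invariant w v) (α-invariant w' v'))
                   (IsAut⇒E⁼-invariant (idTimes t β) β-aut (f v , w) (f v' , w'))

  IsAut⇒PreservesBlocks : ∀ γ → IsAut wreathGraph γ → PreservesBlocks γ
  IsAut⇒PreservesBlocks γ aut v v' w with proj₂ (γ · (v , w)) ≟ᵂ proj₂ (γ · (v' , w))
  ... | yes same = same
  ... | no differ with () ← trans (sym (sameBlock-≢ _ _ differ))
                          (trans (cong proj₁ (aut (v , w) (v' , w) (differ ∘ cong (proj₂ ∘ (γ ·_)))))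
                                 (sameBlock-≡ v v' w))

  IsAut-descends : ∀ γ → IsAut wreathGraph γ → (δ : Perm (Fin t × W)) →
    (∀ i w → δ · (i , w) ≡ orbitOf (γ · (s i , w))) → IsAut Δ δ
  IsAut-descends γ aut δ δ-lifts = E⁼-invariant⇒IsAut δ invariant
    where
    invariant : ∀ z z' → z ≢ z' → E⁼ (δ · z) (δ · z') ≡ E⁼ z z'
    invariant (i , w) (i' , w') z≢z' = begin
      E⁼ (δ · (i , w)) (δ · (i' , w'))
        ≡⟨ cong₂ E⁼ (δ-lifts i w) (δ-lifts i' w') ⟩
      E⁼ (orbitOf (γ · (s i , w))) (orbitOf (γ · (s i' , w')))
        ≡⟨ cong proj₂ (aut (s i , w) (s i' , w') x≢x') ⟩
      E⁼ (f (s i) , w) (f (s i') , w')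
        ≡⟨ cong₂ (λ j j' → E⁼ (j , w) (j' , w')) (f∘s i) (f∘s i') ⟩
      E⁼ (i , w) (i' , w') ∎
      where
      open ≡-Reasoning
      x≢x' : (s i , w) ≢ (s i' , w')
      x≢x' e = z≢z' (subst₂ (λ j j' → (j , w) ≡ (j' , w')) (f∘s i) (f∘s i') (cong orbitOf e))

  module Decompose (v₀ : V) (γ : Perm (V × W)) (aut : IsAut wreathGraph γ) where
    open Blockwise v₀ γ (IsAut⇒PreservesBlocks γ aut)
      (IsAut⇒PreservesBlocks (↔-sym γ) (IsAut-⁻¹ wreathGraph γ aut)) public

    fibrePerm-aut : ∀ w → IsAut Γ (fibrePerm w)
    fibrePerm-aut w v v' v≢v' = just-injective (begin
      just (Eᴳ (fibrePerm w · v) (fibrePerm w · v'))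
        ≡⟨ sameBlock-≡ _ _ _ ⟨
      sameBlock (fibrePerm w · v , blockPerm · w) (fibrePerm w · v' , blockPerm · w)
        ≡⟨ cong₂ sameBlock (decomposition v w) (decomposition v' w) ⟨
      sameBlock (γ · (v , w)) (γ · (v' , w))
        ≡⟨ cong proj₁ (aut (v , w) (v' , w) (v≢v' ∘ cong proj₁)) ⟩
      sameBlock (v , w) (v' , w)
        ≡⟨ sameBlock-≡ v v' w ⟩
      just (Eᴳ v v') ∎)
      where open ≡-Reasoning

    blockPerm-lifts : (∀ w → Invariant f (fibrePerm w)) →
      ∀ i w → idTimes t blockPerm · (i , w) ≡ orbitOf (γ · (s i , w))
    blockPerm-lifts α-invariant i w = begin
      (i , blockPerm · w)
        ≡⟨ cong (_, blockPerm · w) (trans (α-invariant w (s i)) (f∘s i)) ⟨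
      orbitOf (fibrePerm w · s i , blockPerm · w)
        ≡⟨ cong orbitOf (decomposition (s i) w) ⟨
      orbitOf (γ · (s i , w)) ∎
      where open ≡-Reasoning

    -- When f is a bijection, γ itself induces an automorphism of Δ.
    fibrePerm-invariant : (∀ δ → IsAut Δ δ → ∀ z → proj₁ (δ · z) ≡ proj₁ z) →
      Injective _≡_ _≡_ f → ∀ w → Invariant f (fibrePerm w)
    fibrePerm-invariant Δ-fixes-proj₁ f-injective w v =
      trans (cong (λ u → f (proj₁ (γ · (u , w)))) (sym (s∘f v)))
            (Δ-fixes-proj₁ δ (IsAut-descends γ aut δ (λ _ _ → refl)) (f v , w))
      where
      s∘f : ∀ v → s (f v) ≡ v
      s∘f v = f-injective (f∘s (f v))

      orbitOf↔ : (V × W) ↔ (Fin t × W)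
      orbitOf↔ = mk↔ₛ′ orbitOf (λ z → s (proj₁ z) , proj₂ z)
        (λ z → cong (_, proj₂ z) (f∘s (proj₁ z))) (λ x → cong (_, proj₂ x) (s∘f (proj₁ x)))

      δ : Perm (Fin t × W)
      δ = conj orbitOf↔ γ

OrbitGraph : {V : Set} {t : ℕ} → (Perm V → Set) → (V → Fin t) → Set₁
OrbitGraph {V} A f = Σ (ColoredGraph V) λ Γ →
  (∀ α → A α ⇔ (IsAut Γ α × Invariant f α)) ×
  ((∀ α → IsAut Γ α → Invariant f α) ⊎ Injective _≡_ _≡_ f)

module _ {V W : Set} (_≟ᵂ_ : DecidableEquality W) {t : ℕ} (v₀ : V)
  {A : Perm V → Set} {B : Perm W → Set} (B-group : IsPermGroup B)
  (f : V → Fin t) (f-surjective : Surjective _≡_ _≡_ f)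
  (Γ : ColoredGraph V) (A⇔ : ∀ α → A α ⇔ (IsAut Γ α × Invariant f α))
  (Γ-recognises-orbits : (∀ α → IsAut Γ α → Invariant f α) ⊎ Injective _≡_ _≡_ f)
  (Δ : ColoredGraph (Fin t × W)) (B⇔ : ∀ δ → IdTimes t B δ ⇔ IsAut Δ δ) where

  open WreathGraph _≟ᵂ_ Γ Δ f f-surjective

  Wreath⇒IsAut : ∀ γ → Wreath A B γ → IsAut wreathGraph γ
  Wreath⇒IsAut γ (α , Aα , β , Bβ , γ-action) =
    blockwise⇒IsAut α β γ (λ w → proj₁ (to (A⇔ (α w)) (Aα w)))
                          (λ w → proj₂ (to (A⇔ (α w)) (Aα w)))
      (to (B⇔ (idTimes t β)) (IdTimes-idTimes Bβ)) γ-action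

  IsAut⇒Wreath : ∀ γ → IsAut wreathGraph γ → Wreath A B γ
  IsAut⇒Wreath γ aut = fibrePerm , Aα , blockPerm , Bβ , decomposition
    where
    open Decompose v₀ γ aut

    α-invariant : ∀ w → Invariant f (fibrePerm w)
    α-invariant = [ (λ Γ-invariant w → Γ-invariant (fibrePerm w) (fibrePerm-aut w))
                  , fibrePerm-invariant (λ δ → IdTimes-fixes-proj₁ {B = B} {δ} ∘ from (B⇔ δ)) ]′
                  Γ-recognises-orbits

    Aα : ∀ w → A (fibrePerm w)
    Aα w = from (A⇔ (fibrePerm w)) (fibrePerm-aut w , α-invariant w)

    Bβ : B blockPerm
    Bβ = IdTimes-idTimes⁻ B-group (f v₀)
           (from (B⇔ (idTimes t blockPerm))
             (IsAut-descends γ aut (idTimes t blockPerm) (blockPerm-lifts α-invariant)))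

  Wreath-GR : GR (Wreath A B)
  Wreath-GR = IsAut⇒GR wreathGraph λ γ → mk⇔ (Wreath⇒IsAut γ) (IsAut⇒Wreath γ)

module _ {V : Set} {A : Perm V → Set} {t : ℕ} (f : V → Fin t)
  (orbits : ∀ x y → (f x ≡ f y) ⇔ (∃ λ σ → A σ × σ · x ≡ y)) where

  GR⇒OrbitGraph : GR A → OrbitGraph A f
  GR⇒OrbitGraph A∈GR =
    Γ , (λ α → mk⇔ (λ Aα → to (A⇔Aut α) Aα , invariant α Aα) (from (A⇔Aut α) ∘ proj₁))
      , inj₁ (λ α → invariant α ∘ from (A⇔Aut α))
    where
    Γ = proj₁ (GR⇒IsAut A∈GR)
    A⇔Aut = proj₂ (GR⇒IsAut A∈GR)
    invariant = HasOrbits-invariant f orbits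

  I₂⇒OrbitGraph : IsI₂ A → OrbitGraph A f
  I₂⇒OrbitGraph (_ , A⇔id) =
    monochrome , (λ α → mk⇔ (λ Aα → (λ _ _ _ → refl) , HasOrbits-invariant f orbits α Aα)
                            (λ (_ , α-invariant) → from (A⇔id α) (f-injective ∘ α-invariant)))
      , inj₂ f-injective
    where
    monochrome : ColoredGraph V
    monochrome = record { Color = ⊤ ; E = λ _ _ → tt ; E-sym = λ _ _ _ → refl }

    f-injective : Injective _≡_ _≡_ f
    f-injective = HasOrbits-injective f orbits (λ σ → to (A⇔id σ))

lemma2p7 : (p q t : ℕ) → p ≥ 2 → q ≥ 2 →
    (A : Perm (Fin p) → Set) → (B : Perm (Fin q) → Set) →
    IsPermGroup A → IsPermGroup B →
    GR A ⊎ IsI₂ A →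
    t ≥ 1 → HasOrbits A t →
    GR (IdTimes t B) →
    GR (Wreath A B)
lemma2p7 p q t p≥2 _ A B _ B-group A∈GR⊎I₂ _ (f , f-surjective , orbits) B∈GR
  with Γ , A⇔ , Γ-recognises-orbits ← [ GR⇒OrbitGraph f orbits , I₂⇒OrbitGraph f orbits ]′ A∈GR⊎I₂
     | Δ , B⇔ ← GR⇒IsAut B∈GR
  = Wreath-GR _≟ᶠ_ (fromℕ< p≥2) B-group f f-surjective Γ A⇔ Γ-recognises-orbits Δ B⇔
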